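{- For the cycle $C_n$ with $n\ge 3$, $$PRC(C_n)=\begin{cases} n & \text{if } n\in\{3,4,6\},\\ 3 & \text{if } n=5,\\ 4 & \text{if } n=8,\\ 5 & \text{if } n\in\{7,11\},\\ 6 & \text{otherwise.}\end{cases}$$
   Context: All graphs are simple, finite and undirected. A set $S\subseteq V(G)$ is a dominating set if every vertex not in $S$ has a neighbor in $S$; $S$ is a perfect dominating set if every vertex in $V(G)\setminus S$ has exactly one neighbor in $S$. A perfect coalition in $G$ consists of two disjoint sets $V_1,V_2$ of vertices such that (i) neither $V_1$ nor $V_2$ is a dominating set of $G$; (ii) each vertex in $V(G)\setminus V_1$ has at most one neighbor in $V_1$, and each vertex in $V(G)\setminus V_2$ has at most one neighbor in $V_2$; (iii) $V_1\cup V_2$ is a perfect dominating set of $G$. A perfect coalition partition ($prc$-partition) of $G$ is a vertex partition $\pi=\{V_1,\dots,V_k\}$ such that each $V_i$ either is a singleton dominating set or forms a perfect coalition with some $V_j\in\pi$. $PRC(G)$ is the maximum cardinality of a $prc$-partition of $G$, with $PRC(G)=0$ if $G$ has no $prc$-partition. $C_n$ denotes the cycle on $n$ vertices. -}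

module Defs where

open import Data.Nat using (ℕ; zero; suc; _≤_)
open import Data.Fin using (Fin; toℕ)
open import Data.Product using (Σ; ∃; _×_; _,_)
open import Data.Sum using (_⊎_)
open import Relation.Nullary using (¬_)
open import Relation.Binary.PropositionalEquality using (_≡_; _≢_)
open import Function.Bundles using (_⇔_)
open import Function.Definitions using (Surjective)

record Graph : Set₁ where
  field
    n   : ℕ
    Adj : Fin n → Fin n → Set
open Graph public

CycleAdj : (n : ℕ) → Fin n → Fin n → Set
CycleAdj n i j =
  (suc (toℕ i) ≡ toℕ j) ⊎ (suc (toℕ j) ≡ toℕ i)
  ⊎ ((toℕ i ≡ 0 × suc (toℕ j) ≡ n) ⊎ (toℕ j ≡ 0 × suc (toℕ i) ≡ n))

C : ℕ → Graph
C n = record { n = n ; Adj = CycleAdj n }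

VSet : Graph → Set₁
VSet G = Fin (n G) → Set

module _ (G : Graph) where
  private
    V = Fin (n G)
    _~_ = Adj G

  Dominating : VSet G → Set
  Dominating S = ∀ v → ¬ S v → ∃ λ u → S u × (u ~ v)

  AtMostOneNbr : VSet G → V → Set
  AtMostOneNbr S v = ∀ u w → S u → S w → u ~ v → w ~ v → u ≡ w

  ExactlyOneNbr : VSet G → V → Set
  ExactlyOneNbr S v = (∃ λ u → S u × (u ~ v)) × AtMostOneNbr S v

  PerfectDominating : VSet G → Set
  PerfectDominating S = ∀ v → ¬ S v → ExactlyOneNbr S v

  Union : VSet G → VSet G → VSet G
  Union A B v = A v ⊎ B v

  Disjoint : VSet G → VSet G → Set
  Disjoint A B = ∀ v → A v → B v → Data.Empty.⊥
    where import Data.Empty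

  PerfectCoalition : VSet G → VSet G → Set
  PerfectCoalition A B =
    Disjoint A B
    × ¬ Dominating A × ¬ Dominating B
    × (∀ v → ¬ A v → AtMostOneNbr A v)
    × (∀ v → ¬ B v → AtMostOneNbr B v)
    × PerfectDominating (Union A B)

  Singleton : VSet G → Set
  Singleton S = ∃ λ v → ∀ w → (S w ⇔ (w ≡ v))

  -- A partition of V(G) into k (nonempty) blocks V_0,…,V_{k-1}, encoded by
  -- a surjective block-assignment f : V → Fin k; block i is {v | f v ≡ i}.
  Block : ∀ {k} → (V → Fin k) → Fin k → VSet G
  Block f i v = f v ≡ i

  IsPRCPartition : (k : ℕ) → (V → Fin k) → Set
  IsPRCPartition k f =
    Surjective _≡_ _≡_ f
    × (∀ i → (Singleton (Block f i) × Dominating (Block f i))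
             ⊎ (∃ λ j → i ≢ j × PerfectCoalition (Block f i) (Block f j)))

  HasPRCPartition : ℕ → Set
  HasPRCPartition k = Σ (V → Fin k) (IsPRCPartition k)

  -- PRC(G) ≡ m : m is the maximum cardinality of a prc-partition,
  -- or m = 0 and G has no prc-partition.
  PRCis : ℕ → Set
  PRCis m =
    (HasPRCPartition m × (∀ k → HasPRCPartition k → k ≤ m))
    ⊎ (m ≡ 0 × (∀ k → ¬ HasPRCPartition k))

prcCycle : ℕ → ℕ
prcCycle 3  = 3
prcCycle 4  = 4
prcCycle 5  = 3
prcCycle 6  = 6
prcCycle 7  = 5
prcCycle 8  = 4
prcCycle 11 = 5
prcCycle _  = 6

{-# OPTIONS --safe #-}
module Submission where

-- For n ≥ 4 no single vertex dominates C_n, so a prc-partition is a colouring f of C_n in which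
-- every colour i has a partner j whose block forms a perfect coalition with that of i.  On a
-- cycle this only depends on the windows (f (v - 1), f v, f (v + 1)): every window must satisfy
-- a local condition for i and j, and some window must miss i and some window must miss j.
--
-- A window shows at most three colours, every window shows a colour or its
-- partner, and every partner is missed by some window.  With seven colours, two colours missing
-- from some window would share a partner; choosing fresh colours outside two windows at a time
-- then produces either four distinct colours in one window or two windows without a common
-- colour, both impossible.  So there are at most six blocks.  For n ∈ {5, 7, 8, 11} the remaining
-- values of k are refuted by an exhaustive search over colourings in restricted-growth form
-- (every colouring is one up to renaming the colours), pruned by the local window conditions.
--
-- Explicit colourings, checked by the decision procedures.  For the infinite
-- family the colourings P ρ ρ … ρ with ρ = 4 1 5 repeated at least twice all have the same set
-- of windows, and being a prc-partition depends only on that set.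

open import Defs
open import Data.Bool using (Bool; true; false; T; _∧_; _∨_; not)
open import Data.Bool.ListAction using (any; all)
open import Data.Bool.Properties using (T-∧; T-∨)
open import Data.Empty using (⊥; ⊥-elim)
open import Data.Fin as Fin using (Fin; zero; suc; toℕ; fromℕ; fromℕ<; inject₁; lower₁; join; splitAt; #_)
open import Data.Fin.Permutation using (Permutation′; _⟨$⟩ʳ_; _⟨$⟩ˡ_; inverseʳ; inverseˡ; _∘ₚ_; transpose; id)
import Data.Fin.Permutation.Components as PC
open import Data.Fin.Properties
  using (toℕ-injective; toℕ<n; toℕ-fromℕ; toℕ-fromℕ<; toℕ-inject₁; toℕ-lower₁; inject₁-lower₁;
         lower₁-inject₁′; toℕ-inject₁-≢; injective⇒≤; splitAt-join; any?; all?)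
open import Data.List using (List; []; _∷_; _++_; length; lookup; allFin)
open import Data.List.Membership.Propositional using (_∈_; _∉_; lose)
open import Data.List.Membership.Propositional.Properties using (∈-lookup; ∈-++⁺ˡ; ∈-++⁺ʳ; ∈-allFin)
open import Data.List.Membership.Setoid.Properties using (index-injective)
import Data.List.Membership.DecPropositional as DecMembership
open import Data.List.Relation.Unary.Any as Any using (Any; here; there; index)
open import Data.List.Relation.Unary.Any.Properties using (any⁺; map⁻; Any-⊎⁻)
open import Data.List.Relation.Unary.All as All using (All; []; _∷_)
open import Data.List.Relation.Unary.All.Properties using (¬Any⇒All¬; all⁻)
import Data.List.Relation.Unary.All.Properties as ListAll
open import Data.List.Relation.Unary.AllPairs using ([]; _∷_)
open import Data.List.Relation.Unary.Unique.Propositional using (Unique)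
open import Data.Nat as ℕ using (ℕ; zero; suc; _+_; _*_; _≤_; _<_; z≤n; s≤s)
open import Data.Nat.DivMod using (_divMod_; result)
open import Data.Nat.Properties
  using (suc-injective; <⇒≢; m<n+m; ≤∧≢⇒<; ≤-trans; ≤-refl; ≤-reflexive; <⇒≤; <⇒≱; ≮⇒≥; ≰⇒>;
         ≤-<-trans; <-irrefl; n≮n; n≤1+n; m≤m+n; m≤n+m; +-suc; m≤n⇒m<n∨m≡n; ≡ᵇ⇒≡; ≡⇒≡ᵇ; ≤⇒≤ᵇ)
open import Data.Product using (_×_; _,_; ∃; ∃₂; proj₁; proj₂; uncurry)
open import Data.Sum using (_⊎_; inj₁; inj₂)
import Data.Sum as Sum
open import Data.Sum.Properties using (inj₁-injective; inj₂-injective)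
open import Data.Unit using (⊤; tt)
open import Data.Vec as Vec using (Vec; []; _∷_; tabulate)
open import Data.Vec.Properties using (map-∘; tabulate-∘; lookup∘tabulate)
import Data.Vec.Relation.Unary.All as VecAll
import Data.Vec.Relation.Unary.All.Properties as VecAll
import Data.Vec.Relation.Unary.Any as VecAny
import Data.Vec.Relation.Unary.Any.Properties as VecAny
open import Function using (_∘_)
open import Function.Bundles using (_⇔_; mk⇔; Equivalence)
open import Level using (0ℓ)
open import Relation.Binary.Definitions using (DecidableEquality)
open import Relation.Binary.PropositionalEquality
open ≡-Reasoning
open import Relation.Nullary using (¬_; ¬?; yes; no; Dec; contradiction; map′)
import Relation.Nullary.Decidable as Dec
open import Relation.Nullary.Decidable
  using (⌊_⌋; True; T?; toWitness; fromWitness; decidable-stable; dec-true; dec-false; _×-dec_; _⊎-dec_; _→-dec_)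
open import Relation.Unary using (Pred; Decidable; _∪_)
open import Relation.Unary.Properties using (_∪?_)

3≤n⇒n≢2 : ∀ {n} → 3 ≤ n → n ≢ 2
3≤n⇒n≢2 3≤n refl = contradiction 3≤n λ { (s≤s (s≤s ())) }

prev : ∀ {n} → Fin n → Fin n
prev {suc m} zero = fromℕ m
prev (suc i)      = inject₁ i

next : ∀ {n} → Fin n → Fin n
next {suc m} i with m ℕ.≟ toℕ i
... | yes _  = zero
... | no m≢i = suc (lower₁ i m≢i)

next-prev : ∀ {n} (v : Fin n) → next (prev v) ≡ v
next-prev {suc m} zero with m ℕ.≟ toℕ (fromℕ m)
... | yes _  = refl
... | no m≢m = contradiction (sym (toℕ-fromℕ m)) m≢m
next-prev {suc m} (suc i) with m ℕ.≟ toℕ (inject₁ i)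
... | yes m≡i = contradiction m≡i (toℕ-inject₁-≢ i)
... | no m≢i  = cong suc (lower₁-inject₁′ i m≢i)

prev-next : ∀ {n} (v : Fin n) → prev (next v) ≡ v
prev-next {suc m} v with m ℕ.≟ toℕ v
... | yes m≡v = toℕ-injective (trans (toℕ-fromℕ m) m≡v)
... | no m≢v  = inject₁-lower₁ v m≢v

next-inject₁ : ∀ {n} (i : Fin n) → next (inject₁ i) ≡ suc i
next-inject₁ i = next-prev (suc i)

toℕ-next : ∀ {n} (v : Fin n) →
           (suc (toℕ v) < n × toℕ (next v) ≡ suc (toℕ v)) ⊎ (suc (toℕ v) ≡ n × toℕ (next v) ≡ 0)
toℕ-next {suc m} v with m ℕ.≟ toℕ v
... | yes m≡v = inj₂ (cong suc (sym m≡v) , refl)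
... | no m≢v  = inj₁ (s≤s (≤∧≢⇒< (ℕ.s≤s⁻¹ (toℕ<n v)) (m≢v ∘ sym)) , cong suc (toℕ-lower₁ v m≢v))

prev≢next : ∀ {n} → 3 ≤ n → (v : Fin n) → prev v ≢ next v
prev≢next {suc m} 3≤n zero e with toℕ-next {suc m} zero
... | inj₁ (_ , next≡1) = 3≤n⇒n≢2 3≤n (cong suc (trans (sym (toℕ-fromℕ m)) (trans (cong toℕ e) next≡1)))
... | inj₂ (refl , _)   = contradiction 3≤n λ { (s≤s ()) }
prev≢next 3≤n (suc i) e with toℕ-next (suc i)
... | inj₁ (_ , next≡)     = <⇒≢ (m<n+m (toℕ i) {2} (s≤s z≤n)) (trans (sym (toℕ-inject₁ i)) (trans (cong toℕ e) next≡))
... | inj₂ (last , next≡0) =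
  3≤n⇒n≢2 3≤n (trans (sym last) (cong (λ x → suc (suc x)) (trans (sym (toℕ-inject₁ i)) (trans (cong toℕ e) next≡0))))

prev-adjacent : ∀ {n} (v : Fin n) → CycleAdj n (prev v) v
prev-adjacent {suc m} zero = inj₂ (inj₂ (inj₂ (refl , cong suc (toℕ-fromℕ m))))
prev-adjacent (suc i)      = inj₁ (cong suc (toℕ-inject₁ i))

adjacent⇔ : ∀ {n} {u v : Fin n} → CycleAdj n u v ⇔ (u ≡ prev v ⊎ u ≡ next v)
adjacent⇔ {n} {u} {v} = mk⇔ to from
  where
  prev⇒ : ∀ {x y : Fin n} → suc (toℕ x) ≡ toℕ y → x ≡ prev y
  prev⇒ {y = suc j} e = toℕ-injective (trans (suc-injective e) (sym (toℕ-inject₁ j)))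
  wrap⇒ : ∀ {x y : Fin n} → toℕ y ≡ 0 → suc (toℕ x) ≡ n → x ≡ prev y
  wrap⇒ {y = zero} _ e = toℕ-injective (trans (suc-injective e) (sym (toℕ-fromℕ _)))
  next⇐ : v ≡ prev u → u ≡ next v
  next⇐ refl = sym (next-prev u)
  to : CycleAdj n u v → u ≡ prev v ⊎ u ≡ next v
  to (inj₁ e)                     = inj₁ (prev⇒ e)
  to (inj₂ (inj₁ e))              = inj₂ (next⇐ (prev⇒ e))
  to (inj₂ (inj₂ (inj₁ (e , e′)))) = inj₂ (next⇐ (wrap⇒ e e′))
  to (inj₂ (inj₂ (inj₂ (e , e′)))) = inj₁ (wrap⇒ e e′)
  swap : ∀ {x y : Fin n} → CycleAdj n x y → CycleAdj n y x
  swap (inj₁ e)               = inj₂ (inj₁ e)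
  swap (inj₂ (inj₁ e))        = inj₁ e
  swap (inj₂ (inj₂ (inj₁ w))) = inj₂ (inj₂ (inj₂ w))
  swap (inj₂ (inj₂ (inj₂ w))) = inj₂ (inj₂ (inj₁ w))
  from : u ≡ prev v ⊎ u ≡ next v → CycleAdj n u v
  from (inj₁ refl) = prev-adjacent v
  from (inj₂ refl) = swap (subst (λ w → CycleAdj n w (next v)) (prev-next v) (prev-adjacent (next v)))

next-adjacent : ∀ {n} (v : Fin n) → CycleAdj n (next v) v
next-adjacent v = Equivalence.from adjacent⇔ (inj₂ refl)

module _ {A : Set} where

  unique⇒lookup-injective : ∀ {xs : List A} → Unique xs → ∀ {i j} → lookup xs i ≡ lookup xs j → i ≡ j
  unique⇒lookup-injective (_ ∷ _)   {zero}  {zero}  _ = refl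
  unique⇒lookup-injective (x∉ ∷ _)  {zero}  {suc j} e = contradiction e (All.lookup x∉ (∈-lookup j))
  unique⇒lookup-injective (x∉ ∷ _)  {suc i} {zero}  e = contradiction (sym e) (All.lookup x∉ (∈-lookup i))
  unique⇒lookup-injective (_ ∷ uxs) {suc i} {suc j} e = cong suc (unique⇒lookup-injective uxs e)

  unique⇒length≤ : ∀ {xs ys : List A} → Unique xs → All (_∈ ys) xs → length xs ≤ length ys
  unique⇒length≤ {xs} uxs xs⊆ys = injective⇒≤ λ e →
    unique⇒lookup-injective uxs (index-injective (setoid A) (member _) (member _) e)
    where
    member : ∀ i → lookup xs i ∈ _
    member i = All.lookup xs⊆ys (∈-lookup i)

  unique⇒⊇ : DecidableEquality A → ∀ {xs ys : List A} → Unique xs → All (_∈ ys) xs → length ys ≤ length xs →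
              ∀ {y} → y ∈ ys → y ∈ xs
  unique⇒⊇ _≟_ {xs} uxs xs⊆ys |ys|≤|xs| {y} y∈ys with y ∈? xs
    where open DecMembership _≟_ using (_∈?_)
  ... | yes y∈xs = y∈xs
  ... | no  y∉xs =
    contradiction (≤-trans (unique⇒length≤ (¬Any⇒All¬ xs y∉xs ∷ uxs) (y∈ys ∷ xs⊆ys)) |ys|≤|xs|) (n≮n _)

-- Colour equality through toℕ: under evaluation this is far faster than the structural
-- Data.Fin._≟_, which matters for the decisions and searches below.
_==_ : ∀ {k} → Fin k → Fin k → Bool
x == y = toℕ x ℕ.≡ᵇ toℕ y

≡⇔== : ∀ {k} {x y : Fin k} → x ≡ y ⇔ T (x == y)
≡⇔== = mk⇔ (λ e → ≡⇒≡ᵇ _ _ (cong toℕ e)) (λ t → toℕ-injective (≡ᵇ⇒≡ _ _ t))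

_≟_ : ∀ {k} → DecidableEquality (Fin k)
x ≟ y = map′ (Equivalence.from ≡⇔==) (Equivalence.to ≡⇔==) (T? (x == y))

fresh : ∀ {k} (xs : List (Fin k)) → length xs < k → ∃ λ z → z ∉ xs
fresh {k} xs |xs|<k = decidable-stable (any? λ z → ¬? (z ∈? xs)) λ ¬∃ →
  let member z = decidable-stable (z ∈? xs) (¬∃ ∘ (z ,_))
  in <⇒≱ |xs|<k (injective⇒≤ λ e → index-injective (setoid (Fin k)) (member _) (member _) e)
  where open DecMembership _≟_ using (_∈?_)

record Window (A : Set) : Set where
  constructor ⟨_,_,_⟩
  field
    left centre right : A

⟨⟩-cong : ∀ {A : Set} {a a′ b b′ c c′ : A} → a ≡ a′ → b ≡ b′ → c ≡ c′ → ⟨ a , b , c ⟩ ≡ ⟨ a′ , b′ , c′ ⟩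
⟨⟩-cong refl refl refl = refl

colours : ∀ {A} → Window A → List A
colours ⟨ a , b , c ⟩ = a ∷ b ∷ c ∷ []

mapʷ : ∀ {A B : Set} → (A → B) → Window A → Window B
mapʷ σ ⟨ a , b , c ⟩ = ⟨ σ a , σ b , σ c ⟩

window : ∀ {n} {A : Set} → (Fin n → A) → Fin n → Window A
window f v = ⟨ f (prev v) , f v , f (next v) ⟩

_⊑_ : ∀ {n m} {A : Set} → (Fin n → A) → (Fin m → A) → Set
W ⊑ W′ = ∀ v → ∃ λ u → W v ≡ W′ u

module _ {A : Set} (T : Pred A 0ℓ) where

  Meets : Window A → Set
  Meets w = Any T (colours w)

  AtMostOneSide : Window A → Set
  AtMostOneSide ⟨ a , b , c ⟩ = ¬ T b → ¬ (T a × T c)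

  SomeSide : Window A → Set
  SomeSide ⟨ a , b , c ⟩ = ¬ T b → T a ⊎ T c

module _ {A : Set} {T : Pred A 0ℓ} (T? : Decidable T) where

  meets? : Decidable (Meets T)
  meets? w = Any.any? T? (colours w)

  atMostOneSide? : Decidable (AtMostOneSide T)
  atMostOneSide? ⟨ a , b , c ⟩ = ¬? (T? b) →-dec ¬? (T? a ×-dec T? c)

  someSide? : Decidable (SomeSide T)
  someSide? ⟨ a , b , c ⟩ = ¬? (T? b) →-dec (T? a ⊎-dec T? c)

  someSide⇒meets : ∀ w → SomeSide T w → Meets T w
  someSide⇒meets ⟨ a , b , c ⟩ some with T? b
  ... | yes Tb  = there (here Tb)
  ... | no  ¬Tb = Sum.[ here , there ∘ there ∘ here ]′ (some ¬Tb)

module _ {A B : Set} {T : Pred A 0ℓ} (T′ : Pred B 0ℓ) {σ : A → B} (T′∘σ⇔T : ∀ a → T′ (σ a) ⇔ T a) where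

  private
    to : ∀ {a} → T′ (σ a) → T a
    to = Equivalence.to (T′∘σ⇔T _)
    from : ∀ {a} → T a → T′ (σ a)
    from = Equivalence.from (T′∘σ⇔T _)

  meets-mapʷ : ∀ w → Meets T′ (mapʷ σ w) → Meets T w
  meets-mapʷ ⟨ _ , _ , _ ⟩ = Any.map to ∘ map⁻

  atMostOneSide-mapʷ : ∀ w → AtMostOneSide T w → AtMostOneSide T′ (mapʷ σ w)
  atMostOneSide-mapʷ ⟨ _ , _ , _ ⟩ amo ¬T′b (T′a , T′c) = amo (¬T′b ∘ from) (to T′a , to T′c)

  someSide-mapʷ : ∀ w → SomeSide T w → SomeSide T′ (mapʷ σ w)
  someSide-mapʷ ⟨ _ , _ , _ ⟩ some ¬T′b = Sum.map from from (some (¬T′b ∘ from))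

-- Perfect coalitions on a cycle are local

module _ {n : ℕ} (S : Fin n → Set) {v : Fin n} where

  someNbr⇔ : (∃ λ u → S u × CycleAdj n u v) ⇔ (S (prev v) ⊎ S (next v))
  someNbr⇔ = mk⇔ to from
    where
    to : (∃ λ u → S u × CycleAdj n u v) → S (prev v) ⊎ S (next v)
    to (u , Su , u~v) with Equivalence.to adjacent⇔ u~v
    ... | inj₁ refl = inj₁ Su
    ... | inj₂ refl = inj₂ Su
    from : S (prev v) ⊎ S (next v) → ∃ λ u → S u × CycleAdj n u v
    from (inj₁ Sp) = prev v , Sp , prev-adjacent v
    from (inj₂ Sn) = next v , Sn , next-adjacent v

  atMostOneNbr⇔ : 3 ≤ n → AtMostOneNbr (C n) S v ⇔ (¬ (S (prev v) × S (next v)))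
  atMostOneNbr⇔ 3≤n = mk⇔ to from
    where
    to : AtMostOneNbr (C n) S v → ¬ (S (prev v) × S (next v))
    to amo (Sp , Sn) = prev≢next 3≤n v (amo _ _ Sp Sn (prev-adjacent v) (next-adjacent v))
    from : ¬ (S (prev v) × S (next v)) → AtMostOneNbr (C n) S v
    from ¬both u w Su Sw u~v w~v with Equivalence.to adjacent⇔ u~v | Equivalence.to adjacent⇔ w~v
    ... | inj₁ refl | inj₁ refl = refl
    ... | inj₂ refl | inj₂ refl = refl
    ... | inj₁ refl | inj₂ refl = contradiction (Su , Sw) ¬both
    ... | inj₂ refl | inj₁ refl = contradiction (Sw , Su) ¬both

module _ {n : ℕ} {A : Set} {T : Pred A 0ℓ} (f : Fin n → A) where

  meets⇒dominating : (∀ v → Meets T (window f v)) → Dominating (C n) (T ∘ f)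
  meets⇒dominating meets v ¬Sv with meets v
  ... | here Sp                 = prev v , Sp , prev-adjacent v
  ... | there (here Sv)         = contradiction Sv ¬Sv
  ... | there (there (here Sn)) = next v , Sn , next-adjacent v

  escape⇒¬dominating : ∀ d → ¬ Meets T (window f d) → ¬ Dominating (C n) (T ∘ f)
  escape⇒¬dominating d ¬meets dom with dom d (¬meets ∘ there ∘ here)
  ... | u , Su , u~d with Equivalence.to adjacent⇔ u~d
  ...   | inj₁ refl = ¬meets (here Su)
  ...   | inj₂ refl = ¬meets (there (there (here Su)))

  ¬dominating⇒escape : Decidable T → ¬ Dominating (C n) (T ∘ f) → ∃ λ d → ¬ Meets T (window f d)
  ¬dominating⇒escape T? ¬dom with any? (λ d → ¬? (meets? T? (window f d)))
  ... | yes escape = escape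
  ... | no ¬escape = contradiction (meets⇒dominating λ v → decidable-stable (meets? T? _) (¬escape ∘ (v ,_))) ¬dom

  atMostOneSide⇔ : 3 ≤ n → (∀ v → ¬ T (f v) → AtMostOneNbr (C n) (T ∘ f) v) ⇔ (∀ v → AtMostOneSide T (window f v))
  atMostOneSide⇔ 3≤n = mk⇔ (λ amo v ¬Sv → Equivalence.to (atMostOneNbr⇔ _ 3≤n) (amo v ¬Sv))
                           (λ amo v ¬Sv → Equivalence.from (atMostOneNbr⇔ _ 3≤n) (amo v ¬Sv))

  perfectDominating⇔ : 3 ≤ n →
    PerfectDominating (C n) (T ∘ f) ⇔ (∀ v → SomeSide T (window f v) × AtMostOneSide T (window f v))
  perfectDominating⇔ 3≤n = mk⇔
    (λ pd v → (λ ¬Sv → Equivalence.to (someNbr⇔ _) (proj₁ (pd v ¬Sv)))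
            , (λ ¬Sv → Equivalence.to (atMostOneNbr⇔ _ 3≤n) (proj₂ (pd v ¬Sv))))
    (λ loc v ¬Sv → Equivalence.from (someNbr⇔ _) (proj₁ (loc v) ¬Sv)
                 , Equivalence.from (atMostOneNbr⇔ _ 3≤n) (proj₂ (loc v) ¬Sv))

singleton-¬dominating : ∀ {n} → 4 ≤ n → {S : Fin n → Set} → Singleton (C n) S → ¬ Dominating (C n) S
singleton-¬dominating 4≤n {S} (u , S⇔≡u) dom with fresh (u ∷ prev u ∷ next u ∷ []) 4≤n
... | w , w∉ with dom w (w∉ ∘ here ∘ Equivalence.to (S⇔≡u w))
...   | x , Sx , x~w with Equivalence.to (S⇔≡u x) Sx
...     | refl with Equivalence.to adjacent⇔ x~w
...       | inj₁ refl = w∉ (there (there (here (sym (next-prev w)))))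
...       | inj₂ refl = w∉ (there (here (sym (prev-next w))))

CoalitionWindow : ∀ {k} → Fin k → Fin k → Window (Fin k) → Set
CoalitionWindow i j w = AtMostOneSide (_≡ i) w × AtMostOneSide (_≡ j) w
                      × SomeSide ((_≡ i) ∪ (_≡ j)) w × AtMostOneSide ((_≡ i) ∪ (_≡ j)) w

coalitionWindow? : ∀ {k} (i j : Fin k) → Decidable (CoalitionWindow i j)
coalitionWindow? i j w = atMostOneSide? (_≟ i) w ×-dec atMostOneSide? (_≟ j) w
                       ×-dec someSide? ((_≟ i) ∪? (_≟ j)) w ×-dec atMostOneSide? ((_≟ i) ∪? (_≟ j)) w

module _ {n k : ℕ} where

  LocalCoalitionOn : (Fin n → Window (Fin k)) → Fin k → Fin k → Set
  LocalCoalitionOn W i j = (∃ λ d → ¬ Meets (_≡ i) (W d)) × (∃ λ d → ¬ Meets (_≡ j) (W d))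
                         × (∀ v → CoalitionWindow i j (W v))

  PartneredOn : (Fin n → Window (Fin k)) → Set
  PartneredOn W = ∀ i → ∃ λ j → i ≢ j × LocalCoalitionOn W i j

  LocalCoalition : (Fin n → Fin k) → Fin k → Fin k → Set
  LocalCoalition f = LocalCoalitionOn (window f)

  Partnered : (Fin n → Fin k) → Set
  Partnered f = PartneredOn (window f)

  Onto : (Fin n → Fin k) → Set
  Onto f = ∀ i → ∃ λ v → f v ≡ i

partneredOn-⊑ : ∀ {n m k} {W : Fin n → Window (Fin k)} {W′ : Fin m → Window (Fin k)} →
                W ⊑ W′ → W′ ⊑ W → PartneredOn W → PartneredOn W′
partneredOn-⊑ {W = W} {W′} W⊑W′ W′⊑W partnered i =
  let j , i≢j , (dᵢ , escᵢ) , (dⱼ , escⱼ) , windows = partnered i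
  in j , i≢j , moved escᵢ (W⊑W′ dᵢ) , moved escⱼ (W⊑W′ dⱼ)
   , λ v → subst (CoalitionWindow i j) (sym (proj₂ (W′⊑W v))) (windows _)
  where
  moved : ∀ {c d} → ¬ Meets (_≡ c) (W d) → (∃ λ u → W d ≡ W′ u) → ∃ λ u → ¬ Meets (_≡ c) (W′ u)
  moved esc (u , same) = u , subst (λ w → ¬ Meets _ w) same esc

onto-⊑ : ∀ {n m k} {f : Fin n → Fin k} {g : Fin m → Fin k} → window f ⊑ window g → Onto f → Onto g
onto-⊑ f⊑g onto i = let v , fv≡i = onto i ; u , same = f⊑g v in u , trans (sym (cong Window.centre same)) fv≡i

module _ {n k : ℕ} where

  onto? : (f : Fin n → Fin k) → Dec (Onto f)
  onto? f = all? λ i → any? λ v → f v ≟ i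

  PartneredVec : Vec (Window (Fin k)) n → Set
  PartneredVec ws = ∀ i → ∃ λ j → i ≢ j × VecAny.Any (¬_ ∘ Meets (_≡ i)) ws × VecAny.Any (¬_ ∘ Meets (_≡ j)) ws
                                       × VecAll.All (CoalitionWindow i j) ws

  partneredVec? : ∀ ws → Dec (PartneredVec ws)
  partneredVec? ws = all? λ i → any? λ j → ¬? (i ≟ j)
    ×-dec VecAny.any? (¬? ∘ meets? (_≟ i)) ws ×-dec VecAny.any? (¬? ∘ meets? (_≟ j)) ws
    ×-dec VecAll.all? (coalitionWindow? i j) ws

  tabulated⇔partnered : ∀ {f : Fin n → Fin k} → PartneredVec (tabulate (window f)) ⇔ Partnered f
  tabulated⇔partnered {f} = mk⇔ to from
    where
    to : PartneredVec (tabulate (window f)) → Partnered f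
    to tabulated i = let j , i≢j , escᵢ , escⱼ , windows = tabulated i
                     in j , i≢j , VecAny.tabulate⁻ escᵢ , VecAny.tabulate⁻ escⱼ , VecAll.tabulate⁻ windows
    from : Partnered f → PartneredVec (tabulate (window f))
    from partnered i = let j , i≢j , (dᵢ , escᵢ) , (dⱼ , escⱼ) , windows = partnered i
                       in j , i≢j , VecAny.tabulate⁺ dᵢ escᵢ , VecAny.tabulate⁺ dⱼ escⱼ , VecAll.tabulate⁺ windows

  -- Deciding on the tabulated windows computes every window once, not once per pair of colours.
  partnered? : (f : Fin n → Fin k) → Dec (Partnered f)
  partnered? f = Dec.map tabulated⇔partnered (partneredVec? (tabulate (window f)))

  module _ {f : Fin n → Fin k} {i j : Fin k} (3≤n : 3 ≤ n) where

    coalition⇒local : PerfectCoalition (C n) (Block (C n) f i) (Block (C n) f j) → LocalCoalition f i j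
    coalition⇒local (_ , ¬domᵢ , ¬domⱼ , amoᵢ , amoⱼ , pd) =
        ¬dominating⇒escape {T = _≡ i} f (_≟ i) ¬domᵢ
      , ¬dominating⇒escape {T = _≡ j} f (_≟ j) ¬domⱼ
      , λ v → Equivalence.to (atMostOneSide⇔ {T = _≡ i} f 3≤n) amoᵢ v
            , Equivalence.to (atMostOneSide⇔ {T = _≡ j} f 3≤n) amoⱼ v
            , Equivalence.to (perfectDominating⇔ {T = (_≡ i) ∪ (_≡ j)} f 3≤n) pd v

    local⇒coalition : i ≢ j → LocalCoalition f i j → PerfectCoalition (C n) (Block (C n) f i) (Block (C n) f j)
    local⇒coalition i≢j ((dᵢ , escᵢ) , (dⱼ , escⱼ) , windows) =
        (λ v fv≡i fv≡j → i≢j (trans (sym fv≡i) fv≡j))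
      , escape⇒¬dominating {T = _≡ i} f dᵢ escᵢ
      , escape⇒¬dominating {T = _≡ j} f dⱼ escⱼ
      , Equivalence.from (atMostOneSide⇔ {T = _≡ i} f 3≤n) (proj₁ ∘ windows)
      , Equivalence.from (atMostOneSide⇔ {T = _≡ j} f 3≤n) (proj₁ ∘ proj₂ ∘ windows)
      , Equivalence.from (perfectDominating⇔ {T = (_≡ i) ∪ (_≡ j)} f 3≤n) (proj₂ ∘ proj₂ ∘ windows)

  module _ {f : Fin n → Fin k} where

    prc⇒partnered : 4 ≤ n → IsPRCPartition (C n) k f → Partnered f
    prc⇒partnered 4≤n@(s≤s 3≤n) (_ , blocks) i with blocks i
    ... | inj₁ (singleton , dom)     = contradiction dom (singleton-¬dominating 4≤n singleton)
    ... | inj₂ (j , i≢j , coalition) = j , i≢j , coalition⇒local (≤-trans 3≤n (n≤1+n _)) coalition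

    onto-partnered⇒prc : 3 ≤ n → Onto f → Partnered f → IsPRCPartition (C n) k f
    onto-partnered⇒prc 3≤n onto partnered =
        (λ i → proj₁ (onto i) , λ { refl → proj₂ (onto i) })
      , λ i → let j , i≢j , local = partnered i in inj₂ (j , i≢j , local⇒coalition 3≤n i≢j local)

same-windows⇒prc : ∀ {n m k} {f : Fin n → Fin k} {g : Fin m → Fin k} → 3 ≤ m →
                   window f ⊑ window g → window g ⊑ window f → Onto f → Partnered f → IsPRCPartition (C m) k g
same-windows⇒prc 3≤m f⊑g g⊑f onto partnered =
  onto-partnered⇒prc 3≤m (onto-⊑ f⊑g onto) (partneredOn-⊑ f⊑g g⊑f partnered)

decided-partition : ∀ {n k} (f : Fin n → Fin k) → 3 ≤ n → {_ : True (onto? f ×-dec partnered? f)} →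
                    HasPRCPartition (C n) k
decided-partition f 3≤n {decided} =
  f , uncurry (onto-partnered⇒prc 3≤n) (toWitness {a? = onto? f ×-dec partnered? f} decided)

blocks≤vertices : ∀ {n k} → HasPRCPartition (C n) k → k ≤ n
blocks≤vertices (f , surjective , _) = injective⇒≤ λ {i} {j} e →
  trans (sym (proj₂ (surjective i) refl)) (trans (cong f e) (proj₂ (surjective j) refl))

-- At most six blocks

module _ {k : ℕ} {V : Set} (N : V → Window (Fin k)) (partner : Fin k → Fin k)
         (covers : ∀ c x → c ∈ colours (N x) ⊎ partner c ∈ colours (N x))
         (escapes : ∀ c → ∃ λ d → partner c ∉ colours (N d)) where

  open DecMembership (_≟_ {k}) using (_∈?_)

  private
    _∈ᴺ_ _∉ᴺ_ : Fin k → V → Set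
    c ∈ᴺ x = c ∈ colours (N x)
    c ∉ᴺ x = c ∉ colours (N x)

    partner-present : ∀ {c x} → c ∉ᴺ x → partner c ∈ᴺ x
    partner-present {c} {x} c∉x = Sum.[ (λ c∈x → contradiction c∈x c∉x) , (λ p∈x → p∈x) ] (covers c x)

    separated : ∀ {a b x} → a ∈ᴺ x → b ∉ᴺ x → a ≢ b
    separated a∈x b∉x refl = b∉x a∈x

    three-fill : ∀ {a b c x y} → Unique (a ∷ b ∷ c ∷ []) → All (_∈ᴺ x) (a ∷ b ∷ c ∷ []) →
                 y ∈ᴺ x → y ∈ a ∷ b ∷ c ∷ []
    three-fill distinct present = unique⇒⊇ _≟_ distinct present ≤-refl

    no-four : ∀ {a b c d x} → Unique (a ∷ b ∷ c ∷ d ∷ []) → ¬ All (_∈ᴺ x) (a ∷ b ∷ c ∷ d ∷ [])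
    no-four distinct present = contradiction (unique⇒length≤ distinct present) λ { (s≤s (s≤s (s≤s ()))) }

    record Twins (A : Fin k) : Set where
      field
        one two     : Fin k
        distinct    : one ≢ two
        partner-one : partner one ≡ A
        partner-two : partner two ≡ A
    open Twins

    Absent : ∀ {A} → Twins A → V → Set
    Absent t x = one t ∉ᴺ x × two t ∉ᴺ x

    twins-present : ∀ {A x} (t : Twins A) → A ∉ᴺ x → one t ∈ᴺ x × two t ∈ᴺ x
    twins-present {x = x} t A∉x = present (partner-one t) , present (partner-two t)
      where
      present : ∀ {c} → partner c ≡ _ → c ∈ᴺ x
      present {c} refl = Sum.[ (λ c∈x → c∈x) , (λ p∈x → contradiction p∈x A∉x) ] (covers c x)

    windows-meet : 7 ≤ k → ∀ {d d′} → ¬ (∀ {y} → y ∈ᴺ d′ → y ∉ᴺ d)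
    windows-meet 7≤k {d} {d′} disjoint with fresh (colours (N d) ++ colours (N d′)) 7≤k
    ... | y , y∉ = disjoint (partner-present (y∉ ∘ ∈-++⁺ʳ (colours (N d)))) (partner-present (y∉ ∘ ∈-++⁺ˡ))

    second-twins : 7 ≤ k → ∀ {A v d} (t : Twins A) → Absent t v → A ∉ᴺ d →
                   ∃₂ λ B (s : Twins B) → Absent s v × Absent s d
    second-twins 7≤k {v = v} {d} t (one∉v , two∉v) A∉d with fresh (colours (N v) ++ colours (N d)) 7≤k
    ... | z₁ , z₁∉ with fresh (colours (N v) ++ one t ∷ two t ∷ z₁ ∷ []) 7≤k
    ... | z₂ , z₂∉ = partner z₁ , s , (z₁∉v , z₂∉v) , (z₁∉d , z₂∉d)
      where
      z₁∉v = z₁∉ ∘ ∈-++⁺ˡ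
      z₁∉d = z₁∉ ∘ ∈-++⁺ʳ (colours (N v))
      z₂∉v = z₂∉ ∘ ∈-++⁺ˡ
      B∈v = partner-present z₁∉v
      inside-d : ∀ {y} → y ∈ᴺ d → y ∈ one t ∷ two t ∷ partner z₁ ∷ []
      inside-d = three-fill ((distinct t ∷ separated B∈v one∉v ∘ sym ∷ []) ∷ (separated B∈v two∉v ∘ sym ∷ [])
                              ∷ [] ∷ [])
                            (proj₁ (twins-present t A∉d) ∷ proj₂ (twins-present t A∉d) ∷ partner-present z₁∉d ∷ [])
      z₂∉d : z₂ ∉ᴺ d
      z₂∉d z₂∈d with inside-d z₂∈d
      ... | here e                 = z₂∉ (∈-++⁺ʳ (colours (N v)) (here e))
      ... | there (here e)         = z₂∉ (∈-++⁺ʳ (colours (N v)) (there (here e)))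
      ... | there (there (here e)) = z₂∉v (subst (_∈ᴺ v) (sym e) B∈v)
      partner-z₂ : partner z₂ ≡ partner z₁
      partner-z₂ with inside-d (partner-present z₂∉d)
      ... | here e                 = contradiction (subst (_∈ᴺ v) e (partner-present z₂∉v)) one∉v
      ... | there (here e)         = contradiction (subst (_∈ᴺ v) e (partner-present z₂∉v)) two∉v
      ... | there (there (here e)) = e
      s : Twins (partner z₁)
      s = record { one = z₁ ; two = z₂ ; distinct = λ e → z₂∉ (∈-++⁺ʳ (colours (N v)) (there (there (here (sym e)))))
                 ; partner-one = refl ; partner-two = partner-z₂ }

    twins-clash : 7 ≤ k → ∀ {A B v d} (t : Twins A) → A ∈ᴺ v → A ∉ᴺ d →
                  (s : Twins B) → Absent s v → Absent s d → ⊥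
    twins-clash 7≤k {A} {B} {v} {d} t A∈v A∉d s (z₁∉v , z₂∉v) (z₁∉d , z₂∉d) with escapes (one s)
    ... | d′ , p∉d′ with twins-present s (subst (_∉ᴺ d′) (partner-one s) p∉d′) | A ∈? colours (N d′)
    ... | z₁∈d′ , z₂∈d′ | yes A∈d′ = windows-meet 7≤k (outside-d ∘ inside-d′)
      where
      inside-d′ : ∀ {y} → y ∈ᴺ d′ → y ∈ one s ∷ two s ∷ A ∷ []
      inside-d′ = three-fill ((distinct s ∷ separated A∈v z₁∉v ∘ sym ∷ []) ∷ (separated A∈v z₂∉v ∘ sym ∷ [])
                               ∷ [] ∷ [])
                             (z₁∈d′ ∷ z₂∈d′ ∷ A∈d′ ∷ [])
      outside-d : ∀ {y} → y ∈ one s ∷ two s ∷ A ∷ [] → y ∉ᴺ d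
      outside-d (here refl)                 = z₁∉d
      outside-d (there (here refl))         = z₂∉d
      outside-d (there (there (here refl))) = A∉d
    ... | z₁∈d′ , z₂∈d′ | no A∉d′ =
      no-four ((distinct t ∷ separated w₁∈d z₁∉d ∷ separated w₁∈d z₂∉d ∷ [])
              ∷ (separated w₂∈d z₁∉d ∷ separated w₂∈d z₂∉d ∷ []) ∷ (distinct s ∷ []) ∷ [] ∷ [])
              (proj₁ (twins-present t A∉d′) ∷ proj₂ (twins-present t A∉d′) ∷ z₁∈d′ ∷ z₂∈d′ ∷ [])
      where
      w₁∈d = proj₁ (twins-present t A∉d)
      w₂∈d = proj₂ (twins-present t A∉d)

    no-twins : 7 ≤ k → ∀ {A v} (t : Twins A) → ¬ Absent t v
    no-twins 7≤k {v = v} t (one∉v , two∉v) =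
      let d , p∉d = escapes (one t)
          A∉d = subst (_∉ᴺ d) (partner-one t) p∉d
          A∈v = subst (_∈ᴺ v) (partner-one t) (partner-present one∉v)
          _ , s , s∉v , s∉d = second-twins 7≤k t (one∉v , two∉v) A∉d
      in twins-clash 7≤k t A∈v A∉d s s∉v s∉d

    -- Injective as soon as no two colours missing from N v share a partner.
    code : V → Fin k → Fin 3 ⊎ Fin 3
    code v c with c ∈? colours (N v)
    ... | yes c∈v = inj₁ (index c∈v)
    ... | no  c∉v = inj₂ (index (partner-present c∉v))

    code-injective : 7 ≤ k → ∀ v {c c′} → code v c ≡ code v c′ → c ≡ c′
    code-injective 7≤k v {c} {c′} e with c ∈? colours (N v) | c′ ∈? colours (N v)
    ... | yes c∈v | yes c′∈v = index-injective (setoid _) c∈v c′∈v (inj₁-injective e)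
    ... | yes _   | no _     = contradiction e λ ()
    ... | no _    | yes _    = contradiction e λ ()
    ... | no c∉v  | no c′∉v with c ≟ c′
    ...   | yes c≡c′ = c≡c′
    ...   | no  c≢c′ = ⊥-elim (no-twins 7≤k t (c∉v , c′∉v))
      where
      t : Twins (partner c)
      t = record { one = c ; two = c′ ; distinct = c≢c′ ; partner-one = refl
                 ; partner-two = sym (index-injective (setoid _) (partner-present c∉v) (partner-present c′∉v)
                                                      (inj₂-injective e)) }

  partnered-colours≤6 : V → k ≤ 6
  partnered-colours≤6 v with k ℕ.≤? 6
  ... | yes k≤6 = k≤6
  ... | no  k≰6 = contradiction (injective⇒≤ (code-injective (≰⇒> k≰6) v ∘ join-injective)) k≰6
    where
    join-injective : ∀ {x y} → join 3 3 x ≡ join 3 3 y → x ≡ y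
    join-injective {x} {y} e = trans (sym (splitAt-join 3 3 x)) (trans (cong (splitAt 3) e) (splitAt-join 3 3 y))

prc-blocks≤6 : ∀ {n k} → 4 ≤ n → HasPRCPartition (C n) k → k ≤ 6
prc-blocks≤6 {suc _} 4≤n (f , prc) = partnered-colours≤6 (window f) (proj₁ ∘ partnered) covers escapes zero
  where
  partnered = prc⇒partnered 4≤n prc
  covers : ∀ c x → c ∈ colours (window f x) ⊎ proj₁ (partnered c) ∈ colours (window f x)
  covers c x = let j , _ , _ , _ , windows = partnered c ; _ , _ , some , _ = windows x
               in Sum.map (Any.map sym) (Any.map sym) (Any-⊎⁻ (someSide⇒meets ((_≟ c) ∪? (_≟ j)) _ some))
  escapes : ∀ c → ∃ λ d → proj₁ (partnered c) ∉ colours (window f d)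
  escapes c = let _ , _ , _ , (d , esc) , _ = partnered c in d , esc ∘ Any.map sym

-- Exhaustive search over colourings in canonical form

permute-partnered : ∀ {n k} (π : Permutation′ k) {f : Fin n → Fin k} → Partnered f → Partnered ((π ⟨$⟩ʳ_) ∘ f)
permute-partnered {n} {k} π {f} partnered c =
  let i = π ⟨$⟩ˡ c
      j , i≢j , (dᵢ , escᵢ) , (dⱼ , escⱼ) , windows = partnered i
  in subst (λ c → ∃ λ j → c ≢ j × LocalCoalition ((π ⟨$⟩ʳ_) ∘ f) c j) (inverseʳ π)
       ( π ⟨$⟩ʳ j , i≢j ∘ injective
       , (dᵢ , escᵢ ∘ meets-mapʷ (_≡ π ⟨$⟩ʳ i) single _)
       , (dⱼ , escⱼ ∘ meets-mapʷ (_≡ π ⟨$⟩ʳ j) single _)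
       , λ v → let amoᵢ , amoⱼ , some , amo = windows v
               in atMostOneSide-mapʷ (_≡ π ⟨$⟩ʳ i) single _ amoᵢ , atMostOneSide-mapʷ (_≡ π ⟨$⟩ʳ j) single _ amoⱼ
                , someSide-mapʷ ((_≡ π ⟨$⟩ʳ i) ∪ (_≡ π ⟨$⟩ʳ j)) pair _ some
                , atMostOneSide-mapʷ ((_≡ π ⟨$⟩ʳ i) ∪ (_≡ π ⟨$⟩ʳ j)) pair _ amo )
  where
  injective : ∀ {a b} → π ⟨$⟩ʳ a ≡ π ⟨$⟩ʳ b → a ≡ b
  injective e = trans (sym (inverseˡ π)) (trans (cong (π ⟨$⟩ˡ_) e) (inverseˡ π))
  single : ∀ {i} a → (π ⟨$⟩ʳ a ≡ π ⟨$⟩ʳ i) ⇔ (a ≡ i)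
  single a = mk⇔ injective (cong (π ⟨$⟩ʳ_))
  pair : ∀ {i j} a → ((_≡ π ⟨$⟩ʳ i) ∪ (_≡ π ⟨$⟩ʳ j)) (π ⟨$⟩ʳ a) ⇔ ((_≡ i) ∪ (_≡ j)) a
  pair a = mk⇔ (Sum.map injective injective) (Sum.map (cong (π ⟨$⟩ʳ_)) (cong (π ⟨$⟩ʳ_)))

module _ {A : Set} (P : Window A → Set) where

  Triplewise : ∀ {r} → Vec A r → Set
  Triplewise []               = ⊤
  Triplewise (x ∷ [])         = ⊤
  Triplewise (x ∷ y ∷ [])     = ⊤
  Triplewise (x ∷ y ∷ z ∷ xs) = P ⟨ x , y , z ⟩ × Triplewise (y ∷ z ∷ xs)

  triplewise-tail : ∀ {r} x (xs : Vec A r) → Triplewise (x ∷ xs) → Triplewise xs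
  triplewise-tail x []           _         = tt
  triplewise-tail x (y ∷ [])     _         = tt
  triplewise-tail x (y ∷ z ∷ xs) (_ , tw)  = tw

  triplewise-cycle : ∀ {r} (g : Fin (suc (suc r)) → A) → (∀ v → P (window g v)) → Triplewise (tabulate g)
  triplewise-cycle g windows = along g λ i →
    subst (λ v → P ⟨ g (inject₁ (inject₁ i)) , g (suc (inject₁ i)) , g v ⟩) (next-inject₁ (suc i))
          (windows (suc (inject₁ i)))
    where
    along : ∀ {r} (h : Fin (suc (suc r)) → A) →
             (∀ i → P ⟨ h (inject₁ (inject₁ i)) , h (suc (inject₁ i)) , h (suc (suc i)) ⟩) → Triplewise (tabulate h)
    along {zero}  h _     = tt
    along {suc r} h inner = inner zero , along (h ∘ suc) (inner ∘ suc)

module _ {A : Set} (t : A → Bool) where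

  atMostOneSideᵇ : Window A → Bool
  atMostOneSideᵇ ⟨ a , b , c ⟩ = t b ∨ not (t a ∧ t c)

  someSideᵇ : Window A → Bool
  someSideᵇ ⟨ a , b , c ⟩ = t b ∨ t a ∨ t c

module _ {A : Set} {S : Pred A 0ℓ} (t : A → Bool) (S⇔t : ∀ x → S x ⇔ T (t x)) where

  private
    holds : ∀ {x} → t x ≡ true → S x
    holds e = Equivalence.from (S⇔t _) (subst T (sym e) tt)
    fails : ∀ {x} → t x ≡ false → ¬ S x
    fails e = subst T e ∘ Equivalence.to (S⇔t _)

  atMostOneSide⇒ᵇ : ∀ w → AtMostOneSide S w → T (atMostOneSideᵇ t w)
  atMostOneSide⇒ᵇ ⟨ a , b , c ⟩ amo with t b in tb | t a in ta | t c in tc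
  ... | true  | _     | _     = tt
  ... | false | false | _     = tt
  ... | false | true  | false = tt
  ... | false | true  | true  = amo (fails tb) (holds ta , holds tc)

  someSide⇒ᵇ : ∀ w → SomeSide S w → T (someSideᵇ t w)
  someSide⇒ᵇ ⟨ a , b , c ⟩ some with t b in tb | t a in ta | t c in tc
  ... | true  | _     | _     = tt
  ... | false | true  | _     = tt
  ... | false | false | true  = tt
  ... | false | false | false = Sum.[ fails ta , fails tc ] (some (fails tb))

-- Faster to evaluate than coalitionWindow?.
coalitionWindowᵇ : ∀ {k} → Fin k → Fin k → Window (Fin k) → Bool
coalitionWindowᵇ i j w = atMostOneSideᵇ (_== i) w ∧ atMostOneSideᵇ (_== j) w
                       ∧ someSideᵇ (λ x → x == i ∨ x == j) w ∧ atMostOneSideᵇ (λ x → x == i ∨ x == j) w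

coalitionWindow⇒ᵇ : ∀ {k} {i j : Fin k} w → CoalitionWindow i j w → T (coalitionWindowᵇ i j w)
coalitionWindow⇒ᵇ {i = i} {j} w (amoᵢ , amoⱼ , some , amo) =
  ∧⁺ (atMostOneSide⇒ᵇ (_== i) (λ x → ≡⇔== {x = x}) w amoᵢ)
     (∧⁺ (atMostOneSide⇒ᵇ (_== j) (λ x → ≡⇔== {x = x}) w amoⱼ)
     (∧⁺ (someSide⇒ᵇ either either⇔ w some) (atMostOneSide⇒ᵇ either either⇔ w amo)))
  where
  ∧⁺ : ∀ {a b} → T a → T b → T (a ∧ b)
  ∧⁺ ta tb = Equivalence.from T-∧ (ta , tb)
  either : _ → Bool
  either x = x == i ∨ x == j
  either⇔ : ∀ x → (x ≡ i ⊎ x ≡ j) ⇔ T (either x)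
  either⇔ _ = mk⇔ (Equivalence.from T-∨ ∘ Sum.map (Equivalence.to ≡⇔==) (Equivalence.to ≡⇔==))
               (Sum.map (Equivalence.from ≡⇔==) (Equivalence.from ≡⇔==) ∘ Equivalence.to T-∨)

module _ {A : Set} (p : Window A → Bool) where

  triplewiseᵇ : ∀ {r} → Vec A r → Bool
  triplewiseᵇ (x ∷ y ∷ z ∷ xs) = p ⟨ x , y , z ⟩ ∧ triplewiseᵇ (y ∷ z ∷ xs)
  triplewiseᵇ _                = true

  triplewise⇒ᵇ : ∀ {P : Window A → Set} → (∀ w → P w → T (p w)) →
                 ∀ {r} (xs : Vec A r) → Triplewise P xs → T (triplewiseᵇ xs)
  triplewise⇒ᵇ P⇒p []               _          = tt
  triplewise⇒ᵇ P⇒p (x ∷ [])         _          = tt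
  triplewise⇒ᵇ P⇒p (x ∷ y ∷ [])     _          = tt
  triplewise⇒ᵇ P⇒p (x ∷ y ∷ z ∷ xs) (Pxyz , tw) =
    Equivalence.from T-∧ (P⇒p _ Pxyz , triplewise⇒ᵇ P⇒p (y ∷ z ∷ xs) tw)

transpose-left : ∀ {k} (i j : Fin k) → PC.transpose i j i ≡ j
transpose-left i j rewrite dec-true (i Fin.≟ i) refl = refl

transpose-other : ∀ {k} {i j z : Fin k} → z ≢ i → z ≢ j → PC.transpose i j z ≡ z
transpose-other {i = i} {j} {z} z≢i z≢j rewrite dec-false (z Fin.≟ i) z≢i | dec-false (z Fin.≟ j) z≢j = refl

map-fixed : ∀ {A : Set} {f : A → A} {r} {xs : Vec A r} → VecAll.All (λ z → f z ≡ z) xs → Vec.map f xs ≡ xs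
map-fixed VecAll.[]       = refl
map-fixed (fx≡x VecAll.∷ fixed) = cong₂ _∷_ fx≡x (map-fixed fixed)

module _ {k : ℕ} where

  grow : ℕ → Fin k → ℕ
  grow b x with toℕ x ℕ.≟ b
  ... | yes _ = suc b
  ... | no  _ = b

  -- Read from the last entry to the first, each entry reuses one of the b labels opened so far or
  -- opens label b.
  data Canonical : ∀ {r} → ℕ → Vec (Fin k) r → Set where
    []  : Canonical 0 []
    _∷_ : ∀ {r b x} {xs : Vec (Fin k) r} → toℕ x ≤ b → Canonical b xs → Canonical (grow b x) (x ∷ xs)

  canonical-labels : ∀ {r b} {xs : Vec (Fin k) r} → Canonical b xs → VecAll.All (λ z → toℕ z < b) xs
  canonical-labels []                            = VecAll.[]
  canonical-labels (_∷_ {b = b} {x} x≤b canonical) with toℕ x ℕ.≟ b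
  ... | yes _   = s≤s x≤b VecAll.∷ VecAll.map (λ z<b → ≤-trans z<b (n≤1+n b)) (canonical-labels canonical)
  ... | no  x≢b = ≤∧≢⇒< x≤b x≢b VecAll.∷ canonical-labels canonical

  canonicalise : ∀ {r} (xs : Vec (Fin k) r) → ∃₂ λ (π : Permutation′ k) b → Canonical b (Vec.map (π ⟨$⟩ʳ_) xs)
  canonicalise []       = id , 0 , []
  canonicalise (x ∷ xs) with canonicalise xs
  ... | π , b , canonical with toℕ (π ⟨$⟩ʳ x) ℕ.<? b
  ...   | yes πx<b = π , _ , <⇒≤ πx<b ∷ canonical
  ...   | no  πx≮b = π ∘ₚ transpose y label , _
                   , subst (λ z → toℕ z ≤ b) (sym (transpose-left y label)) (≤-reflexive (toℕ-fromℕ< b<k))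
                     ∷ subst (Canonical b) (sym tail-fixed) canonical
    where
    y = π ⟨$⟩ʳ x
    b<k : b < k
    b<k = ≤-<-trans (≮⇒≥ πx≮b) (toℕ<n y)
    label = fromℕ< b<k
    fixed : ∀ {z} → toℕ z < b → PC.transpose y label z ≡ z
    fixed z<b = transpose-other (λ { refl → πx≮b z<b }) (λ { refl → <-irrefl (toℕ-fromℕ< b<k) z<b })
    tail-fixed : Vec.map ((π ∘ₚ transpose y label) ⟨$⟩ʳ_) xs ≡ Vec.map (π ⟨$⟩ʳ_) xs
    tail-fixed = trans (map-∘ _ _ xs) (map-fixed (VecAll.map fixed (canonical-labels canonical)))

  Viable : ∀ {r} → Vec (Fin k) r → Set
  Viable xs = ∀ i → ∃ λ j → i ≢ j × Triplewise (CoalitionWindow i j) xs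

  viableᵇ : ∀ {r} → Vec (Fin k) r → Bool
  viableᵇ xs = all (λ i → any (λ j → not (i == j) ∧ triplewiseᵇ (coalitionWindowᵇ i j) xs) (allFin k)) (allFin k)

  viable⇒ᵇ : ∀ {r} {xs : Vec (Fin k) r} → Viable xs → T (viableᵇ xs)
  viable⇒ᵇ {xs = xs} viable = all⁻ _ (ListAll.tabulate⁺ λ i →
    let j , i≢j , tw = viable i
    in any⁺ _ (lose (∈-allFin j) (Equivalence.from T-∧ (distinct i≢j , triplewise⇒ᵇ _ coalitionWindow⇒ᵇ xs tw))))
    where
    distinct : ∀ {i j : Fin k} → i ≢ j → T (not (i == j))
    distinct {i} {j} i≢j with i == j in e
    ... | true  = i≢j (Equivalence.from ≡⇔== (subst T (sym e) tt))
    ... | false = tt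

  data Suffixwise-viable : ∀ {r} → Vec (Fin k) r → Set where
    []  : Suffixwise-viable []
    _∷_ : ∀ {r x} {xs : Vec (Fin k) r} → Viable (x ∷ xs) → Suffixwise-viable xs → Suffixwise-viable (x ∷ xs)

  viable-suffixes : ∀ {r} (xs : Vec (Fin k) r) → Viable xs → Suffixwise-viable xs
  viable-suffixes []       _      = []
  viable-suffixes (x ∷ xs) viable =
    viable ∷ viable-suffixes xs λ i → let j , i≢j , tw = viable i in j , i≢j , triplewise-tail _ x xs tw

  search : (r : ℕ) → (ℕ → Vec (Fin k) r → Bool) → Bool
  search zero    accept = accept 0 []
  search (suc r) accept = search r λ b xs →
    any (λ x → (toℕ x ℕ.≤ᵇ b) ∧ viableᵇ (x ∷ xs) ∧ accept (grow b x) (x ∷ xs)) (allFin k)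

  search-complete : ∀ {r b} {xs : Vec (Fin k) r} (accept : ℕ → Vec (Fin k) r → Bool) →
                    Canonical b xs → Suffixwise-viable xs → T (accept b xs) → T (search r accept)
  search-complete accept [] _ accepted = accepted
  search-complete accept (_∷_ {x = x} x≤b canonical) (viable ∷ viables) accepted =
    search-complete _ canonical viables (any⁺ _ (lose (∈-allFin x)
      (Equivalence.from T-∧ (≤⇒≤ᵇ x≤b , Equivalence.from T-∧ (viable⇒ᵇ viable , accepted)))))

partnered-vector : ∀ {n k} → ℕ → Vec (Fin k) n → Bool
partnered-vector _ xs = ⌊ partnered? (Vec.lookup xs) ⌋

canonical-witness : ∀ {r k} {f : Fin (suc (suc r)) → Fin k} → Partnered f →
                    ∃₂ λ b (xs : Vec (Fin k) (suc (suc r))) →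
                      Canonical b xs × Suffixwise-viable xs × T (partnered-vector b xs)
canonical-witness {r} {k} {f} partnered-f = witness (canonicalise (tabulate f))
  where
  witness : (∃₂ λ π b → Canonical b (Vec.map (π ⟨$⟩ʳ_) (tabulate f))) →
            ∃₂ λ b (xs : Vec (Fin k) (suc (suc r))) →
              Canonical b xs × Suffixwise-viable xs × T (partnered-vector b xs)
  witness (π , b , canonical) =
      b , tabulate g
    , subst (Canonical b) (sym (tabulate-∘ _ f)) canonical
    , viable-suffixes _ (λ i → let j , i≢j , _ , _ , windows = partnered i in j , i≢j , triplewise-cycle _ g windows)
    , fromWitness {a? = partnered? (Vec.lookup (tabulate g))}
                  (partneredOn-⊑ (λ v → v , same v) (λ v → v , sym (same v)) partnered)
    where
    g = (π ⟨$⟩ʳ_) ∘ f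
    partnered : Partnered g
    partnered = permute-partnered π partnered-f
    same : ∀ v → window g v ≡ window (Vec.lookup (tabulate g)) v
    same v = sym (⟨⟩-cong (lookup∘tabulate g (prev v)) (lookup∘tabulate g v) (lookup∘tabulate g (next v)))

no-prc-partition : ∀ {n k} → 4 ≤ n → search {k} n partnered-vector ≡ false → ¬ HasPRCPartition (C n) k
no-prc-partition 4≤n@(s≤s (s≤s _)) none (_ , prc) =
  let _ , _ , canonical , viables , accepted = canonical-witness (prc⇒partnered 4≤n prc)
  in subst T none (search-complete partnered-vector canonical viables accepted)

linear : ∀ {A : Set} → (ℕ → A) → ℕ → Window A
linear ω x = ⟨ ω x , ω (suc x) , ω (suc (suc x)) ⟩

module _ {A : Set} (ω : ℕ → A) where

  window-first : ∀ {m} → window {suc (suc m)} (ω ∘ toℕ) zero ≡ ⟨ ω (suc m) , ω 0 , ω 1 ⟩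
  window-first {m} with toℕ-next {suc (suc m)} zero
  ... | inj₁ (_ , next≡1) = ⟨⟩-cong (cong ω (toℕ-fromℕ (suc m))) refl (cong ω next≡1)
  ... | inj₂ (1≡n , _)    = contradiction (suc-injective 1≡n) λ ()

  window-last : ∀ {m} → window {suc (suc m)} (ω ∘ toℕ) (fromℕ (suc m)) ≡ ⟨ ω m , ω (suc m) , ω 0 ⟩
  window-last {m} with toℕ-next (fromℕ (suc m))
  ... | inj₁ (last<n , _) =
    contradiction (subst (λ x → suc x < suc (suc m)) (toℕ-fromℕ (suc m)) last<n) (<-irrefl refl ∘ ℕ.s≤s⁻¹)
  ... | inj₂ (_ , next≡0) =
    ⟨⟩-cong (cong ω (trans (toℕ-inject₁ (fromℕ m)) (toℕ-fromℕ m))) (cong ω (toℕ-fromℕ (suc m))) (cong ω next≡0)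

  window-inner : ∀ {n x} (v : Fin n) → toℕ v ≡ suc x → suc (suc x) < n → window (ω ∘ toℕ) v ≡ linear ω x
  window-inner {n} (suc i) v≡1+x inner with toℕ-next (suc i)
  ... | inj₁ (_ , next≡) =
    ⟨⟩-cong (cong ω (trans (toℕ-inject₁ i) (suc-injective v≡1+x))) (cong ω v≡1+x)
            (cong ω (trans next≡ (cong suc v≡1+x)))
  ... | inj₂ (last , _)  = contradiction (subst (_< n) (trans (sym (cong suc v≡1+x)) last) inner) (<-irrefl refl)

vertex-cases : ∀ {m} (v : Fin (suc (suc m))) →
               v ≡ zero ⊎ v ≡ fromℕ (suc m) ⊎ ∃ λ x → toℕ v ≡ suc x × suc (suc x) < suc (suc m)
vertex-cases zero = inj₁ refl
vertex-cases {m} (suc i) with toℕ i ℕ.≟ m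
... | yes i≡m = inj₂ (inj₁ (cong suc (toℕ-injective (trans i≡m (sym (toℕ-fromℕ m))))))
... | no  i≢m = inj₂ (inj₂ (toℕ i , refl , s≤s (s≤s (≤∧≢⇒< (ℕ.s≤s⁻¹ (toℕ<n i)) i≢m))))

prefixed : ∀ {A : Set} → List A → (ℕ → A) → ℕ → A
prefixed []       ρ x       = ρ x
prefixed (p ∷ ps) ρ zero    = p
prefixed (p ∷ ps) ρ (suc x) = prefixed ps ρ x

-- colouring s colours the cycle of length |P| + 6 + 3 s by P followed by ρ ρ ρ …; when ρ has
-- period 3 all of them have the same windows.
module Periodic {A : Set} (P : List A) (ρ : ℕ → A) (ρ-periodic : ∀ x → ρ (3 + x) ≡ ρ x) where

  private
    L = length P
    ω = prefixed P ρ

    ω-periodic : ∀ x → L ≤ x → ω (3 + x) ≡ ω x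
    ω-periodic = go P
      where
      go : ∀ Q x → length Q ≤ x → prefixed Q ρ (3 + x) ≡ prefixed Q ρ x
      go []       x       _         = ρ-periodic x
      go (q ∷ qs) (suc x) (s≤s q≤x) = go qs x q≤x

  span : ℕ → ℕ
  span s = (4 + L) + s * 3

  colouring : ∀ s → Fin (suc (suc (span s))) → A
  colouring s = ω ∘ toℕ

  private
    L≤span : ∀ s → L ≤ span s
    L≤span s = ≤-trans (m≤n+m L 4) (m≤m+n (4 + L) (s * 3))

    span-suc : ∀ s → span (suc s) ≡ 3 + span s
    span-suc s = trans (+-suc (4 + L) (2 + s * 3))
                       (cong suc (trans (+-suc (4 + L) (1 + s * 3)) (cong suc (+-suc (4 + L) (s * 3)))))

    ends : ∀ s → ω (span s) ≡ ω (span 0) × ω (suc (span s)) ≡ ω (suc (span 0))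
    ends zero    = refl , refl
    ends (suc s) = trans (cong ω (span-suc s)) (trans (ω-periodic (span s) (L≤span s)) (proj₁ (ends s)))
                 , trans (cong (ω ∘ suc) (span-suc s))
                         (trans (ω-periodic (suc (span s)) (≤-trans (L≤span s) (n≤1+n _))) (proj₂ (ends s)))

    same-ends : ∀ s t → ω (span s) ≡ ω (span t) × ω (suc (span s)) ≡ ω (suc (span t))
    same-ends s t = trans (proj₁ (ends s)) (sym (proj₁ (ends t))) , trans (proj₂ (ends s)) (sym (proj₂ (ends t)))

    fold : ∀ x → ∃ λ y → y ≤ 2 + L × linear ω x ≡ linear ω y
    fold x with x ℕ.≤? 2 + L
    fold x                   | yes x≤ = x , x≤ , refl
    fold 0                   | no x≰ = contradiction z≤n x≰
    fold 1                   | no x≰ = contradiction (s≤s z≤n) x≰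
    fold 2                   | no x≰ = contradiction (s≤s (s≤s z≤n)) x≰
    fold (suc (suc (suc x))) | no x≰ =
      let y , y≤ , same = fold x
          L≤x = ℕ.s≤s⁻¹ (ℕ.s≤s⁻¹ (ℕ.s≤s⁻¹ (≰⇒> x≰)))
      in y , y≤ , trans (⟨⟩-cong (ω-periodic x L≤x) (ω-periodic (suc x) (≤-trans L≤x (n≤1+n x)))
                                  (ω-periodic (suc (suc x)) (≤-trans L≤x (≤-trans (n≤1+n x) (n≤1+n (suc x)))))) same

  stable : ∀ s t → window (colouring s) ⊑ window (colouring t)
  stable s t v with vertex-cases v
  ... | inj₁ refl = zero , (begin
    window (colouring s) zero         ≡⟨ window-first ω ⟩
    ⟨ ω (suc (span s)) , ω 0 , ω 1 ⟩  ≡⟨ ⟨⟩-cong (proj₂ (same-ends s t)) refl refl ⟩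
    ⟨ ω (suc (span t)) , ω 0 , ω 1 ⟩  ≡⟨ window-first ω ⟨
    window (colouring t) zero         ∎)
  ... | inj₂ (inj₁ refl) = fromℕ (suc (span t)) , (begin
    window (colouring s) (fromℕ (suc (span s)))  ≡⟨ window-last ω ⟩
    ⟨ ω (span s) , ω (suc (span s)) , ω 0 ⟩      ≡⟨ ⟨⟩-cong (proj₁ (same-ends s t)) (proj₂ (same-ends s t)) refl ⟩
    ⟨ ω (span t) , ω (suc (span t)) , ω 0 ⟩      ≡⟨ window-last ω ⟨
    window (colouring t) (fromℕ (suc (span t)))  ∎)
  ... | inj₂ (inj₂ (x , v≡1+x , inner)) =
    let y , y≤ , same = fold x
        y<span = ≤-trans (s≤s y≤) (≤-trans (n≤1+n (3 + L)) (m≤m+n (4 + L) (t * 3)))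
        1+y<n = s≤s (s≤s (<⇒≤ y<span))
        u = fromℕ< 1+y<n
    in u , trans (window-inner ω v v≡1+x inner)
                 (trans same (sym (window-inner ω u (toℕ-fromℕ< 1+y<n) (s≤s (s≤s y<span)))))

ρ415 : ℕ → Fin 6
ρ415 0                   = # 4
ρ415 1                   = # 1
ρ415 2                   = # 5
ρ415 (suc (suc (suc x))) = ρ415 x

module Family (P : List (Fin 6)) where

  open Periodic P ρ415 (λ _ → refl) public

  partition : {_ : True (onto? (colouring 0) ×-dec partnered? (colouring 0))} →
              ∀ s → HasPRCPartition (C (suc (suc (span s)))) 6
  partition {decided} s =
    let onto , partnered = toWitness {a? = onto? (colouring 0) ×-dec partnered? (colouring 0)} decided
    in colouring s , same-windows⇒prc (s≤s (s≤s (s≤s z≤n))) (stable 0 s) (stable s 0) onto partnered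

P₀ P₁ P₂ : List (Fin 6)
P₀ = # 0 ∷ # 2 ∷ # 3 ∷ []
P₁ = # 0 ∷ # 1 ∷ # 2 ∷ # 0 ∷ # 3 ∷ # 1 ∷ # 0 ∷ []
P₂ = # 0 ∷ # 1 ∷ # 1 ∷ # 0 ∷ # 0 ∷ # 1 ∷ # 2 ∷ # 0 ∷ # 3 ∷ # 1 ∷ # 0 ∷ []

3≤ : ∀ {m} → 3 ≤ 3 + m
3≤ = s≤s (s≤s (s≤s z≤n))

4≤ : ∀ {m} → 4 ≤ 4 + m
4≤ = s≤s 3≤

triangle : HasPRCPartition (C 3) 3
triangle = (λ v → v) , (λ i → i , λ { refl → refl })
         , λ i → inj₁ ((i , λ _ → mk⇔ (λ e → e) (λ e → e)) , meets⇒dominating {T = _≡ i} (λ v → v) (everywhere i))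
  where
  everywhere : ∀ i v → Meets (_≡ i) (window (λ v → v) v)
  everywhere = toWitness {a? = all? λ i → all? λ v → meets? (_≟ i) (window (λ v → v) v)} _

square : HasPRCPartition (C 4) 4
square = decided-partition (Vec.lookup (# 0 ∷ # 1 ∷ # 2 ∷ # 3 ∷ [])) 3≤

pentagon : HasPRCPartition (C 5) 3
pentagon = decided-partition (Vec.lookup (# 0 ∷ # 0 ∷ # 1 ∷ # 1 ∷ # 2 ∷ [])) 3≤

heptagon : HasPRCPartition (C 7) 5
heptagon = decided-partition (Vec.lookup (# 0 ∷ # 0 ∷ # 1 ∷ # 2 ∷ # 3 ∷ # 4 ∷ # 1 ∷ [])) 3≤

octagon : HasPRCPartition (C 8) 4
octagon = decided-partition (Vec.lookup (# 0 ∷ # 0 ∷ # 1 ∷ # 1 ∷ # 0 ∷ # 2 ∷ # 3 ∷ # 3 ∷ [])) 3≤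

hendecagon : HasPRCPartition (C 11) 5
hendecagon = decided-partition (Vec.lookup (# 0 ∷ # 0 ∷ # 1 ∷ # 1 ∷ # 0 ∷ # 0 ∷ # 1 ∷ # 2 ∷ # 3 ∷ # 4 ∷ # 1 ∷ [])) 3≤

six-blocks : ∀ m → HasPRCPartition (C (12 + m)) 6
six-blocks m with m divMod 3
... | result q       zero             eq rewrite eq = Family.partition P₀ (suc q)
... | result q       (suc zero)       eq rewrite eq = Family.partition P₁ q
... | result zero    (suc (suc zero)) eq rewrite eq = decided-partition (prefixed P₂ ρ415 ∘ toℕ) 3≤
... | result (suc q) (suc (suc zero)) eq rewrite eq = Family.partition P₂ q

exactly : ∀ {n m} → HasPRCPartition (C n) m → (∀ k → HasPRCPartition (C n) k → k ≤ m) → PRCis (C n) m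
exactly has bound = inj₁ (has , bound)

tighten : ∀ {n m} → (∀ k → HasPRCPartition (C n) k → k ≤ suc m) → ¬ HasPRCPartition (C n) (suc m) →
          ∀ k → HasPRCPartition (C n) k → k ≤ m
tighten bound none k has with m≤n⇒m<n∨m≡n (bound k has)
... | inj₁ k<1+m = ℕ.s≤s⁻¹ k<1+m
... | inj₂ refl  = contradiction has none

at-most-six : ∀ {n} → 4 ≤ n → ∀ k → HasPRCPartition (C n) k → k ≤ 6
at-most-six 4≤n _ = prc-blocks≤6 4≤n

theorem3p7 : ∀ (n : ℕ) → 3 ≤ n → PRCis (C n) (prcCycle n)
theorem3p7 0 ()
theorem3p7 1 (s≤s ())
theorem3p7 2 (s≤s (s≤s ()))
theorem3p7 3  _ = exactly triangle (λ _ → blocks≤vertices)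
theorem3p7 4  _ = exactly square (λ _ → blocks≤vertices)
theorem3p7 5  _ = exactly pentagon
  (tighten (tighten (λ _ → blocks≤vertices) (no-prc-partition 4≤ refl)) (no-prc-partition 4≤ refl))
theorem3p7 6  _ = exactly (decided-partition (prefixed P₀ ρ415 ∘ toℕ) 3≤) (at-most-six 4≤)
theorem3p7 7  _ = exactly heptagon (tighten (at-most-six 4≤) (no-prc-partition 4≤ refl))
theorem3p7 8  _ = exactly octagon
  (tighten (tighten (at-most-six 4≤) (no-prc-partition 4≤ refl)) (no-prc-partition 4≤ refl))
theorem3p7 9  _ = exactly (Family.partition P₀ 0) (at-most-six 4≤)
theorem3p7 10 _ = exactly (decided-partition (prefixed P₁ ρ415 ∘ toℕ) 3≤) (at-most-six 4≤)
theorem3p7 11 _ = exactly hendecagon (tighten (at-most-six 4≤) (no-prc-partition 4≤ refl))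
theorem3p7 (suc (suc (suc (suc (suc (suc (suc (suc (suc (suc (suc (suc m)))))))))))) _ =
  exactly (six-blocks m) (at-most-six 4≤)
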